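{- Let $t \geq 3$, let $p_1 < p_2 < \cdots < p_t$ be odd primes, and let $\alpha_1, \ldots, \alpha_t \geq 1$ be integers. Let $S$ be a set of residue classes modulo $p_1 p_2 \cdots p_t$ with $|S| \geq 2^t$. Then there exist integers $a_{i_1, i_2, \ldots, i_t}$, for $1 \leq i_k \leq \alpha_k$ ($1 \leq k \leq t$), such that the set of congruences $$A = \{a_{i_1, \ldots, i_t} \pmod{p_1^{i_1} p_2^{i_2} \cdots p_t^{i_t}} : 1 \leq i_k \leq \alpha_k,\ 1 \leq k \leq t\}$$ is good and each $a_{i_1, \ldots, i_t}$ reduced modulo $p_1 p_2 \cdots p_t$ lies in $S$.
   Context: Two congruences $a \pmod{b}$ and $a' \pmod{b'}$ overlap if there is an integer $x$ with $x \equiv a \pmod{b}$ and $x \equiv a' \pmod{b'}$. A finite set of congruences $\{a_1 \pmod{d_1}, \ldots, a_t \pmod{d_t}\}$ with pairwise distinct moduli $1 \leq d_1 < \cdots < d_t$ is called good if whenever two distinct congruences $a_i \pmod{d_i}$ and $a_j \pmod{d_j}$ of the set overlap, we have $\gcd(d_i,d_j)=1$. -}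

module Defs where

open import Data.Nat using (ℕ; zero; suc; _*_; _^_; _≤_)
open import Data.Nat.Coprimality using (Coprime)
open import Data.Integer as ℤ using (ℤ; +_; _-_)
open import Data.Integer.Divisibility using () renaming (_∣_ to _∣ℤ_)
open import Data.Fin using (Fin; zero; suc)
open import Data.Product using (∃; ∃-syntax; _×_)
open import Relation.Binary.PropositionalEquality using (_≢_)

prodFin : (t : ℕ) → (Fin t → ℕ) → ℕ
prodFin zero f = 1
prodFin (suc t) f = f zero * prodFin t (λ k → f (suc k))

Overlap : ℤ → ℕ → ℤ → ℕ → Set
Overlap a b a' b' = ∃[ x ] ((+ b) ∣ℤ (x - a) × (+ b') ∣ℤ (x - a'))

ValidIdx : (t : ℕ) → (Fin t → ℕ) → (Fin t → ℕ) → Set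
ValidIdx t α i = ∀ k → 1 ≤ i k × i k ≤ α k

modulus : (t : ℕ) → (Fin t → ℕ) → (Fin t → ℕ) → ℕ
modulus t p i = prodFin t (λ k → p k ^ i k)

GoodFamily : (t : ℕ) → (p α : Fin t → ℕ) → ((Fin t → ℕ) → ℤ) → Set
GoodFamily t p α a =
  ∀ i j → ValidIdx t α i → ValidIdx t α j → (∃[ k ] (i k ≢ j k)) →
    (modulus t p i ≢ modulus t p j)
    × (Overlap (a i) (modulus t p i) (a j) (modulus t p j) →
       Coprime (modulus t p i) (modulus t p j))

-- Colour an index tuple i by the set of coordinates k with i_k ≥ 2. There are only
-- 2^t colours, so distinct colours can be given distinct residues s ∈ S; put
--   a_i = s_(colour of i) + ∏_k p_k^(max(1, i_k − 1)).
-- The product is ≡ 0 mod P = p_1 ⋯ p_t, so a_i ≡ s (mod P). No two congruences of the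
-- family overlap: an overlap of i ≠ j forces a_i ≡ a_j mod P (P divides both moduli),
-- hence equal residues and equal colours. At a coordinate k with i_k < j_k both
-- exponents are then ≥ 2, and modulo p_k^(i_k) (which divides both moduli) the product
-- vanishes for j but has p_k-adic valuation exactly i_k − 1 for i. Distinct index tuples
-- give distinct moduli by comparing p_k-adic valuations.
module Submission where

open import Defs
open import Data.Nat using (ℕ; _≤_; _<_; _^_)
open import Data.Nat.Divisibility using (_∣_)
open import Data.Nat.Primality using (Prime)
open import Data.Integer using (ℤ; +_; _-_)
open import Data.Integer.Divisibility using () renaming (_∣_ to _∣ℤ_)
open import Data.Fin using (Fin) renaming (_<_ to _<ᶠ_)
open import Data.List using (List; length)
open import Data.List.Relation.Unary.All using (All)
open import Data.List.Relation.Unary.Unique.Propositional using (Unique)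
open import Data.List.Membership.Propositional using (_∈_)
open import Data.Product using (∃; ∃-syntax; _×_; Σ-syntax)
open import Relation.Nullary using (¬_)

open import Algebra.Properties.AbelianGroup using (xyx⁻¹≈y)
open import Algebra.Properties.CommutativeSemigroup using (x∙yz≈y∙xz)
open import Data.Empty using (⊥-elim)
open import Data.Fin using (zero; suc; punchIn; combine; inject≤)
open import Data.Fin.Properties
  using (punchInᵢ≢i; combine-injective; inject≤-injective) renaming (<-cmp to <ᶠ-cmp)
open import Data.Integer using (_+_; ∣_∣)
import Data.Integer.Divisibility.Signed as Signed
import Data.Integer.Properties as ℤ
open import Data.List using (_∷_; lookup)
open import Data.List.Membership.Propositional.Properties using (∈-lookup)
import Data.List.Relation.Unary.All as All
open import Data.List.Relation.Unary.AllPairs using (_∷_)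
open import Data.Nat using (zero; suc; _*_; z≤n; s≤s; s≤s⁻¹; NonZero)
open import Data.Nat.Divisibility
  using (∣-refl; ∣-trans; 1∣_; ∣1⇒≡1; m∣m*n; ∣n⇒∣m*n; *-pres-∣; *-monoʳ-∣; *-cancelˡ-∣; >⇒∤)
open import Data.Nat.Primality using (¬prime[1]; euclidsLemma; prime⇒irreducible; prime⇒nonZero)
open import Data.Nat.Properties
  using (*-comm; *-commutativeSemigroup; m^n≢0; <⇒≢; <⇒≤; ≤-refl; ≤-<-trans; <-cmp; ⊔-pres-<m)
open import Data.Product using (_,_; proj₁; proj₂)
open import Data.Sum using ([_,_]′)
open import Function using (_∘_)
open import Function.Definitions using (Injective)
open import Relation.Binary.Definitions using (tri<; tri≈; tri>)
open import Relation.Binary.PropositionalEquality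
  using (_≡_; _≢_; refl; sym; cong; subst; module ≡-Reasoning)
open import Relation.Nullary using (contradiction)

private
  variable
    t n m q d : ℕ
    x y z : ℤ

prime∤1 : Prime q → ¬ q ∣ 1
prime∤1 q-prime q∣1 = ¬prime[1] (subst Prime (∣1⇒≡1 q∣1) q-prime)

prime∣^⇒prime∣ : Prime q → ∀ n → q ∣ m ^ n → q ∣ m
prime∣^⇒prime∣ q-prime zero q∣1 = contradiction q∣1 (prime∤1 q-prime)
prime∣^⇒prime∣ {m = m} q-prime (suc n) q∣m^[1+n] =
  [ (λ q∣m → q∣m) , prime∣^⇒prime∣ q-prime n ]′ (euclidsLemma m (m ^ n) q-prime q∣m^[1+n])

prime∣prime⇒≡ : ∀ {r} → Prime q → Prime r → q ∣ r → q ≡ r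
prime∣prime⇒≡ q-prime r-prime q∣r =
  [ (λ q≡1 → contradiction (subst Prime q≡1 q-prime) ¬prime[1]) , (λ q≡r → q≡r) ]′
    (prime⇒irreducible r-prime q∣r)

m≤n⇒o^m∣o^n : ∀ o → m ≤ n → o ^ m ∣ o ^ n
m≤n⇒o^m∣o^n o z≤n       = 1∣ _
m≤n⇒o^m∣o^n o (s≤s m≤n) = *-monoʳ-∣ o (m≤n⇒o^m∣o^n o m≤n)

1≤n⇒m∣m^n : 1 ≤ n → m ∣ m ^ n
1≤n⇒m∣m^n {suc n} _ = m∣m*n _

∣∧<⇒≡0 : d ∣ n → n < d → n ≡ 0
∣∧<⇒≡0 {n = zero}  _   _   = refl
∣∧<⇒≡0 {n = suc n} d∣n n<d = contradiction d∣n (>⇒∤ n<d)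

∣-prodFin : (f : Fin t → ℕ) (k : Fin t) → f k ∣ prodFin t f
∣-prodFin f zero    = m∣m*n _
∣-prodFin f (suc k) = ∣n⇒∣m*n (f zero) (∣-prodFin (f ∘ suc) k)

prodFin-pres-∣ : {f g : Fin t → ℕ} → (∀ k → f k ∣ g k) → prodFin t f ∣ prodFin t g
prodFin-pres-∣ {zero}  f∣g = ∣-refl
prodFin-pres-∣ {suc t} f∣g = *-pres-∣ (f∣g zero) (prodFin-pres-∣ (f∣g ∘ suc))

prime∤prodFin : {f : Fin t → ℕ} → Prime q → (∀ k → ¬ q ∣ f k) → ¬ q ∣ prodFin t f
prime∤prodFin {zero}      q-prime q∤f = prime∤1 q-prime
prime∤prodFin {suc t} {f = f} q-prime q∤f q∣f₀*rest =
  [ q∤f zero , prime∤prodFin q-prime (q∤f ∘ suc) ]′ (euclidsLemma (f zero) _ q-prime q∣f₀*rest)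

prodFin-punchIn : (f : Fin (suc n) → ℕ) (k : Fin (suc n)) →
                  prodFin (suc n) f ≡ f k * prodFin n (f ∘ punchIn k)
prodFin-punchIn f zero = refl
prodFin-punchIn {suc n} f (suc k) = begin
  f zero * prodFin (suc n) (f ∘ suc)                    ≡⟨ cong (f zero *_) (prodFin-punchIn (f ∘ suc) k) ⟩
  f zero * (f (suc k) * prodFin n (f ∘ suc ∘ punchIn k)) ≡⟨ x∙yz≈y∙xz *-commutativeSemigroup (f zero) (f (suc k)) _ ⟩
  f (suc k) * (f zero * prodFin n (f ∘ suc ∘ punchIn k)) ∎
  where open ≡-Reasoning

*-prime∤prodFin : {f : Fin t → ℕ} (k : Fin t) .{{_ : NonZero (f k)}} → Prime q →
                  (∀ l → l ≢ k → ¬ q ∣ f l) → ¬ f k * q ∣ prodFin t f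
*-prime∤prodFin {suc t} {q = q} {f = f} k q-prime q∤f fₖ*q∣f =
  prime∤prodFin q-prime (λ l → q∤f (punchIn k l) (punchInᵢ≢i k l))
    (*-cancelˡ-∣ (f k) (subst (f k * q ∣_) (prodFin-punchIn f k) fₖ*q∣f))

modulus-pow-∣ : (p e : Fin t → ℕ) (k : Fin t) → n ≤ e k → p k ^ n ∣ modulus t p e
modulus-pow-∣ p e k n≤eₖ = ∣-trans (m≤n⇒o^m∣o^n (p k) n≤eₖ) (∣-prodFin (λ l → p l ^ e l) k)

prodFin∣modulus : (p e : Fin t → ℕ) → (∀ k → 1 ≤ e k) → prodFin t p ∣ modulus t p e
prodFin∣modulus p e e≥1 = prodFin-pres-∣ (λ k → 1≤n⇒m∣m^n (e≥1 k))

module _ {p : Fin t → ℕ} (p-prime : ∀ k → Prime (p k)) (p-injective : Injective _≡_ _≡_ p) where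

  modulus-pow-∤ : (e : Fin t → ℕ) (k : Fin t) → ¬ p k ^ suc (e k) ∣ modulus t p e
  modulus-pow-∤ e k pₖ^[1+eₖ]∣ =
    *-prime∤prodFin {f = λ l → p l ^ e l} k (p-prime k) pₖ∤pₗ^eₗ
      (subst (_∣ modulus t p e) (*-comm (p k) (p k ^ e k)) pₖ^[1+eₖ]∣)
    where
    instance
      pₖ^eₖ≢0 : NonZero (p k ^ e k)
      pₖ^eₖ≢0 = m^n≢0 (p k) (e k) {{prime⇒nonZero (p-prime k)}}
    pₖ∤pₗ^eₗ : ∀ l → l ≢ k → ¬ p k ∣ p l ^ e l
    pₖ∤pₗ^eₗ l l≢k pₖ∣ =
      l≢k (sym (p-injective (prime∣prime⇒≡ (p-prime k) (p-prime l) (prime∣^⇒prime∣ (p-prime k) (e l) pₖ∣))))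

  modulus-≢ : (i j : Fin t → ℕ) {k : Fin t} → i k < j k → modulus t p i ≢ modulus t p j
  modulus-≢ i j {k} iₖ<jₖ mᵢ≡mⱼ =
    modulus-pow-∤ i k (subst (p k ^ suc (i k) ∣_) (sym mᵢ≡mⱼ) (modulus-pow-∣ p j k iₖ<jₖ))

infix 4 _≡_mod_

record _≡_mod_ (x y : ℤ) (d : ℕ) : Set where
  constructor divides-diff
  field
    ∣-diff : + d ∣ℤ (x - y)

open _≡_mod_

≡mod-sym : x ≡ y mod d → y ≡ x mod d
≡mod-sym {x} {y} {d} (divides-diff d∣x-y) = divides-diff (subst (d ∣_) (ℤ.∣i-j∣≡∣j-i∣ x y) d∣x-y)

≡mod-trans : x ≡ y mod d → y ≡ z mod d → x ≡ z mod d
≡mod-trans {x} {y} {d} {z} (divides-diff d∣x-y) (divides-diff d∣y-z) =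
  divides-diff (Signed.∣⇒∣ᵤ (subst (+ d Signed.∣_) (ℤ.+-minus-telescope x y z)
    (Signed.∣m∣n⇒∣m+n (Signed.∣ᵤ⇒∣ {i = x - y} d∣x-y) (Signed.∣ᵤ⇒∣ {i = y - z} d∣y-z))))

≡mod-∣ : d ∣ m → x ≡ y mod m → x ≡ y mod d
≡mod-∣ d∣m (divides-diff m∣x-y) = divides-diff (∣-trans d∣m m∣x-y)

overlap⇒≡mod : ∀ {a b m′} → Overlap a m b m′ → d ∣ m → d ∣ m′ → a ≡ b mod d
overlap⇒≡mod (x , m∣x-a , m′∣x-b) d∣m d∣m′ =
  ≡mod-trans (≡mod-sym (≡mod-∣ d∣m (divides-diff {x} m∣x-a))) (≡mod-∣ d∣m′ (divides-diff {x} m′∣x-b))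

overlap-sym : ∀ {a b m′} → Overlap a m b m′ → Overlap b m′ a m
overlap-sym (x , m∣x-a , m′∣x-b) = x , m′∣x-b , m∣x-a

module _ (x : ℤ) (n : ℕ) where

  private
    [x+n]-x≡n : (x + + n) - x ≡ + n
    [x+n]-x≡n = xyx⁻¹≈y ℤ.+-0-abelianGroup x (+ n)

  ∣⇒+≡mod : d ∣ n → x + + n ≡ x mod d
  ∣⇒+≡mod {d} d∣n = divides-diff (subst (λ z → d ∣ ∣ z ∣) (sym [x+n]-x≡n) d∣n)

  +≡mod⇒∣ : x + + n ≡ x mod d → d ∣ n
  +≡mod⇒∣ {d} (divides-diff d∣x+n-x) = subst (λ z → d ∣ ∣ z ∣) [x+n]-x≡n d∣x+n-x

≡mod⇒≡ : ∀ {r s} → + r ≡ + s mod d → r < d → s < d → r ≡ s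
≡mod⇒≡ {d} {r} {s} (divides-diff d∣r-s) r<d s<d =
  ℤ.+-injective (ℤ.i-j≡0⇒i≡j (+ r) (+ s) (ℤ.∣i∣≡0⇒i≡0 (∣∧<⇒≡0 d∣r-s ∣r-s∣<d)))
  where
  ∣r-s∣<d : ∣ + r - + s ∣ < d
  ∣r-s∣<d = subst (_< d) (cong ∣_∣ (sym (ℤ.[+m]-[+n]≡m⊖n r s)))
    (≤-<-trans (ℤ.∣m⊝n∣≤m⊔n r s) (⊔-pres-<m r<d s<d))

lookup-injective : ∀ {xs : List ℕ} → Unique xs → ∀ i j → lookup xs i ≡ lookup xs j → i ≡ j
lookup-injective {_ ∷ _}  _             zero    zero    _  = refl
lookup-injective {_ ∷ xs} (x∉xs ∷ _)    zero    (suc j) eq = contradiction eq (All.lookup x∉xs (∈-lookup j))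
lookup-injective {_ ∷ xs} (x∉xs ∷ _)    (suc i) zero    eq = contradiction (sym eq) (All.lookup x∉xs (∈-lookup i))
lookup-injective {_ ∷ xs} (_ ∷ unique)  (suc i) (suc j) eq = cong suc (lookup-injective unique i j eq)

encode : (Fin t → Fin 2) → Fin (2 ^ t)
encode {zero}  b = zero
encode {suc t} b = combine (b zero) (encode (b ∘ suc))

encode-injective : (b c : Fin t → Fin 2) → encode b ≡ encode c → ∀ k → b k ≡ c k
encode-injective {suc t} b c eq zero    = proj₁ (combine-injective (b zero) _ (c zero) _ eq)
encode-injective {suc t} b c eq (suc k) =
  encode-injective (b ∘ suc) (c ∘ suc) (proj₂ (combine-injective (b zero) _ (c zero) _ eq)) k

deep : ℕ → Fin 2
deep (suc (suc _)) = suc zero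
deep _             = zero

deep-< : 1 ≤ m → m < n → deep m ≡ deep n → 2 ≤ m
deep-< {suc (suc m)} _ _ _ = s≤s (s≤s z≤n)
deep-< {suc zero} {suc zero}    _ (s≤s ()) _
deep-< {suc zero} {suc (suc n)} _ _        ()

lower : ℕ → ℕ
lower (suc (suc n)) = suc n
lower _             = 1

1≤lower : ∀ n → 1 ≤ lower n
1≤lower (suc (suc n)) = s≤s z≤n
1≤lower (suc zero)    = s≤s z≤n
1≤lower zero          = s≤s z≤n

<⇒≤lower : m < n → m ≤ lower n
<⇒≤lower {n = suc zero}    (s≤s z≤n) = z≤n
<⇒≤lower {n = suc (suc n)} m<n       = s≤s⁻¹ m<n

2≤⇒suc[lower]≡ : 2 ≤ n → suc (lower n) ≡ n
2≤⇒suc[lower]≡ {suc (suc n)} _ = refl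
2≤⇒suc[lower]≡ {suc zero} (s≤s ())

module Construction
  {p : Fin t → ℕ} (p-prime : ∀ k → Prime (p k)) (p-injective : Injective _≡_ _≡_ p)
  {S : List ℕ} (S-unique : Unique S) (S<P : All (_< prodFin t p) S) (2^t≤∣S∣ : 2 ^ t ≤ length S)
  where

  P : ℕ
  P = prodFin t p

  residue : (Fin t → ℕ) → ℕ
  residue i = lookup S (inject≤ (encode (deep ∘ i)) 2^t≤∣S∣)

  residue∈S : ∀ i → residue i ∈ S
  residue∈S i = ∈-lookup _

  residue-injective : ∀ {i j} → residue i ≡ residue j → ∀ k → deep (i k) ≡ deep (j k)
  residue-injective {i} {j} eq = encode-injective (deep ∘ i) (deep ∘ j)
    (inject≤-injective _ _ _ _ (lookup-injective S-unique _ _ eq))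

  a : (Fin t → ℕ) → ℤ
  a i = + residue i + + modulus t p (lower ∘ i)

  a≡residue : ∀ i → a i ≡ + residue i mod P
  a≡residue i = ∣⇒+≡mod (+ residue i) _ (prodFin∣modulus p (lower ∘ i) (1≤lower ∘ i))

  no-overlap : ∀ {i j k} → (∀ l → 1 ≤ i l) → (∀ l → 1 ≤ j l) → i k < j k →
               ¬ Overlap (a i) (modulus t p i) (a j) (modulus t p j)
  no-overlap {i} {j} {k} i≥1 j≥1 iₖ<jₖ i∩j = modulus-pow-∤ p-prime p-injective (lower ∘ i) k pₖ^iₖ∣Zᵢ
    where
    aᵢ≡aⱼ[P] : a i ≡ a j mod P
    aᵢ≡aⱼ[P] = overlap⇒≡mod i∩j (prodFin∣modulus p i i≥1) (prodFin∣modulus p j j≥1)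
    same-residue : residue i ≡ residue j
    same-residue = ≡mod⇒≡
      (≡mod-trans (≡mod-sym (a≡residue i)) (≡mod-trans aᵢ≡aⱼ[P] (a≡residue j)))
      (All.lookup S<P (residue∈S i)) (All.lookup S<P (residue∈S j))
    2≤iₖ : 2 ≤ i k
    2≤iₖ = deep-< (i≥1 k) iₖ<jₖ (residue-injective same-residue k)
    aᵢ≡aⱼ[pₖ^iₖ] : a i ≡ a j mod p k ^ i k
    aᵢ≡aⱼ[pₖ^iₖ] = overlap⇒≡mod i∩j (modulus-pow-∣ p i k ≤-refl) (modulus-pow-∣ p j k (<⇒≤ iₖ<jₖ))
    aⱼ≡residue : a j ≡ + residue i mod p k ^ i k
    aⱼ≡residue = subst (λ r → a j ≡ + r mod p k ^ i k) (sym same-residue)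
      (∣⇒+≡mod (+ residue j) _ (modulus-pow-∣ p (lower ∘ j) k (<⇒≤lower iₖ<jₖ)))
    pₖ^iₖ∣Zᵢ : p k ^ suc (lower (i k)) ∣ modulus t p (lower ∘ i)
    pₖ^iₖ∣Zᵢ = subst (λ e → p k ^ e ∣ modulus t p (lower ∘ i)) (sym (2≤⇒suc[lower]≡ 2≤iₖ))
      (+≡mod⇒∣ (+ residue i) _ (≡mod-trans aᵢ≡aⱼ[pₖ^iₖ] aⱼ≡residue))

  a-good : ∀ α → GoodFamily t p α a
  a-good α i j i-valid j-valid (k , iₖ≢jₖ) with <-cmp (i k) (j k)
  ... | tri< iₖ<jₖ _ _ = modulus-≢ p-prime p-injective i j iₖ<jₖ ,
                         ⊥-elim ∘ no-overlap (proj₁ ∘ i-valid) (proj₁ ∘ j-valid) iₖ<jₖ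
  ... | tri≈ _ iₖ≡jₖ _ = contradiction iₖ≡jₖ iₖ≢jₖ
  ... | tri> _ _ jₖ<iₖ = modulus-≢ p-prime p-injective j i jₖ<iₖ ∘ sym ,
                         ⊥-elim ∘ no-overlap (proj₁ ∘ j-valid) (proj₁ ∘ i-valid) jₖ<iₖ ∘ overlap-sym

  a-residue : ∀ i → ∃[ s ] (s ∈ S × (+ P) ∣ℤ (a i - + s))
  a-residue i = residue i , residue∈S i , ∣-diff (a≡residue i)

strictlyIncreasing⇒injective : {f : Fin t → ℕ} → (∀ k l → k <ᶠ l → f k < f l) → Injective _≡_ _≡_ f
strictlyIncreasing⇒injective {f = f} f-increasing {k} {l} fₖ≡fₗ with <ᶠ-cmp k l
... | tri< k<l _ _ = contradiction fₖ≡fₗ (<⇒≢ (f-increasing k l k<l))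
... | tri≈ _ k≡l _ = k≡l
... | tri> _ _ l<k = contradiction (sym fₖ≡fₗ) (<⇒≢ (f-increasing l k l<k))

lemma7 : (t : ℕ) → 3 ≤ t →
    (p : Fin t → ℕ) → (∀ k → Prime (p k)) → (∀ k → ¬ (2 ∣ p k)) →
    (∀ k l → k <ᶠ l → p k < p l) →
    (α : Fin t → ℕ) → (∀ k → 1 ≤ α k) →
    (S : List ℕ) → Unique S → All (λ s → s < prodFin t p) S →
    2 ^ t ≤ length S →
    ∃[ a ] (GoodFamily t p α a ×
      (∀ i → ValidIdx t α i →
        ∃[ s ] (s ∈ S × (+ prodFin t p) ∣ℤ (a i - + s))))
lemma7 t _ p p-prime _ p-increasing α _ S S-unique S<P 2^t≤∣S∣ =
  a , a-good α , λ i _ → a-residue i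
  where
  open Construction p-prime (strictlyIncreasing⇒injective p-increasing) S-unique S<P 2^t≤∣S∣
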